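{- An axiomatic extension $\vdash$ of $\vdash_{\mathbf{LL}}$ has the deductive interpolation property if and only if it has the guarded interpolation property.
   Context: $\vdash_{\mathbf{LL}}$ is classical linear logic as a deductive system over the language $\{\wedge,\vee,\cdot,\to,1,0,\bot,\top,!\}$, given by the following Hilbert calculus ($\neg\alpha:=\alpha\to0$). Axiom schemes: $\alpha\to\alpha$; $\alpha\wedge\beta\to\alpha$; $\alpha\wedge\beta\to\beta$; $\alpha\to\alpha\vee\beta$; $\beta\to\alpha\vee\beta$; $(\alpha\to\beta)\to((\beta\to\gamma)\to(\alpha\to\gamma))$; $(\alpha\to(\beta\to\gamma))\to(\beta\to(\alpha\to\gamma))$; $(\alpha\to\beta)\wedge(\alpha\to\gamma)\to(\alpha\to\beta\wedge\gamma)$; $(\alpha\to\gamma)\wedge(\beta\to\gamma)\to(\alpha\vee\beta\to\gamma)$; $\alpha\to(\beta\to\alpha\cdot\beta)$; $(\alpha\to(\beta\to\gamma))\to(\alpha\cdot\beta\to\gamma)$; $1$; $1\to(\alpha\to\alpha)$; $\alpha\to\top$; $\bot\to\alpha$; $\neg0$; $\alpha\to(\neg\alpha\to0)$; $\neg\neg\alpha\to\alpha$; $(\alpha\to\neg\beta)\to(\beta\to\neg\alpha)$; $\beta\to(!\alpha\to\beta)$; $(!\alpha\to(!\alpha\to\beta))\to(!\alpha\to\beta)$; $!(\alpha\to\beta)\to(!\alpha\to!\beta)$; $!\alpha\to\alpha$; $!\alpha\to!!\alpha$. Rules: modus ponens, adjunction ($\alpha,\beta/\alpha\wedge\beta$),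 necessitation ($\alpha/!\alpha$). An axiomatic extension of $\vdash_{\mathbf{LL}}$ is a relation $\vdash$ such that for some substitution-closed set $\Sigma$ of formulas, $\Gamma\vdash\varphi\iff\Gamma\cup\Sigma\vdash_{\mathbf{LL}}\varphi$. A logic $\vdash$ has the deductive interpolation property if whenever $\Gamma\vdash\varphi$ there is a set $\Gamma'$ of formulas whose variables occur both in $\Gamma$ and in $\varphi$ with $\Gamma\vdash\psi$ for all $\psi\in\Gamma'$ and $\Gamma'\vdash\varphi$. It has the guarded interpolation property if whenever $\vdash\,!\varphi\to\,!\psi$, there is a formula $\delta$ whose variables occur in both $\varphi$ and $\psi$ such that $\vdash\,!\varphi\to\,!\delta$ and $\vdash\,!\delta\to\,!\psi$. -}

module Defs where

open import Level using (0ℓ)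
open import Data.Nat using (ℕ)
open import Data.Product using (Σ; _×_; ∃)
open import Data.Sum using (_⊎_)
open import Data.Empty using (⊥)
open import Relation.Unary using (Pred; _∪_; ∅)
open import Function.Bundles using (_⇔_)

Var : Set
Var = ℕ

infixr 5 _⇒_
infixr 6 _∨′_
infixr 7 _∧′_
infixr 8 _·_
infix 9 !_

data Formula : Set where
  var  : Var → Formula
  _∧′_ : Formula → Formula → Formula
  _∨′_ : Formula → Formula → Formula
  _·_  : Formula → Formula → Formula
  _⇒_  : Formula → Formula → Formula
  𝟏 𝟎 ⊥′ ⊤′ : Formula
  !_   : Formula → Formula

¬′_ : Formula → Formula
¬′ α = α ⇒ 𝟎

FSet : Set₁
FSet = Pred Formula 0ℓ

data Axiom : Formula → Set where
  ax-id     : ∀ α → Axiom (α ⇒ α)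
  ax-∧l     : ∀ α β → Axiom (α ∧′ β ⇒ α)
  ax-∧r     : ∀ α β → Axiom (α ∧′ β ⇒ β)
  ax-∨l     : ∀ α β → Axiom (α ⇒ α ∨′ β)
  ax-∨r     : ∀ α β → Axiom (β ⇒ α ∨′ β)
  ax-trans  : ∀ α β γ → Axiom ((α ⇒ β) ⇒ ((β ⇒ γ) ⇒ (α ⇒ γ)))
  ax-perm   : ∀ α β γ → Axiom ((α ⇒ (β ⇒ γ)) ⇒ (β ⇒ (α ⇒ γ)))
  ax-∧I     : ∀ α β γ → Axiom ((α ⇒ β) ∧′ (α ⇒ γ) ⇒ (α ⇒ β ∧′ γ))
  ax-∨E     : ∀ α β γ → Axiom ((α ⇒ γ) ∧′ (β ⇒ γ) ⇒ (α ∨′ β ⇒ γ))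
  ax-·I     : ∀ α β → Axiom (α ⇒ (β ⇒ α · β))
  ax-·E     : ∀ α β γ → Axiom ((α ⇒ (β ⇒ γ)) ⇒ (α · β ⇒ γ))
  ax-1      : Axiom 𝟏
  ax-1E     : ∀ α → Axiom (𝟏 ⇒ (α ⇒ α))
  ax-⊤      : ∀ α → Axiom (α ⇒ ⊤′)
  ax-⊥      : ∀ α → Axiom (⊥′ ⇒ α)
  ax-¬0     : Axiom (¬′ 𝟎)
  ax-¬I     : ∀ α → Axiom (α ⇒ (¬′ α ⇒ 𝟎))
  ax-¬¬     : ∀ α → Axiom (¬′ ¬′ α ⇒ α)
  ax-contra : ∀ α β → Axiom ((α ⇒ ¬′ β) ⇒ (β ⇒ ¬′ α))
  ax-!w     : ∀ α β → Axiom (β ⇒ (! α ⇒ β))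
  ax-!c     : ∀ α β → Axiom ((! α ⇒ (! α ⇒ β)) ⇒ (! α ⇒ β))
  ax-!K     : ∀ α β → Axiom (! (α ⇒ β) ⇒ (! α ⇒ ! β))
  ax-!T     : ∀ α → Axiom (! α ⇒ α)
  ax-!4     : ∀ α → Axiom (! α ⇒ ! ! α)

infix 4 _⊢LL_
data _⊢LL_ (Γ : FSet) : Formula → Set where
  hyp : ∀ {φ} → Γ φ → Γ ⊢LL φ
  ax  : ∀ {φ} → Axiom φ → Γ ⊢LL φ
  mp  : ∀ {α β} → Γ ⊢LL α → Γ ⊢LL (α ⇒ β) → Γ ⊢LL β
  adj : ∀ {α β} → Γ ⊢LL α → Γ ⊢LL β → Γ ⊢LL (α ∧′ β)
  nec : ∀ {α} → Γ ⊢LL α → Γ ⊢LL (! α)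

Subst : Set
Subst = Var → Formula

_[_] : Formula → Subst → Formula
var x [ σ ] = σ x
(α ∧′ β) [ σ ] = (α [ σ ]) ∧′ (β [ σ ])
(α ∨′ β) [ σ ] = (α [ σ ]) ∨′ (β [ σ ])
(α · β) [ σ ] = (α [ σ ]) · (β [ σ ])
(α ⇒ β) [ σ ] = (α [ σ ]) ⇒ (β [ σ ])
𝟏 [ σ ] = 𝟏
𝟎 [ σ ] = 𝟎
⊥′ [ σ ] = ⊥′
⊤′ [ σ ] = ⊤′
(! α) [ σ ] = ! (α [ σ ])

SubstClosed : FSet → Set
SubstClosed S = ∀ (σ : Subst) (φ : Formula) → S φ → S (φ [ σ ])

Relation : Set₁
Relation = FSet → Formula → Set

AxiomaticExtension : Relation → Set₁
AxiomaticExtension _⊢_ =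
  Σ FSet λ S → SubstClosed S × (∀ (Γ : FSet) (φ : Formula) → (Γ ⊢ φ) ⇔ ((Γ ∪ S) ⊢LL φ))

data Occurs (x : Var) : Formula → Set where
  o-var : Occurs x (var x)
  o-∧l  : ∀ {α β} → Occurs x α → Occurs x (α ∧′ β)
  o-∧r  : ∀ {α β} → Occurs x β → Occurs x (α ∧′ β)
  o-∨l  : ∀ {α β} → Occurs x α → Occurs x (α ∨′ β)
  o-∨r  : ∀ {α β} → Occurs x β → Occurs x (α ∨′ β)
  o-·l  : ∀ {α β} → Occurs x α → Occurs x (α · β)
  o-·r  : ∀ {α β} → Occurs x β → Occurs x (α · β)
  o-⇒l  : ∀ {α β} → Occurs x α → Occurs x (α ⇒ β)
  o-⇒r  : ∀ {α β} → Occurs x β → Occurs x (α ⇒ β)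
  o-!   : ∀ {α} → Occurs x α → Occurs x (! α)

OccursIn : Var → FSet → Set
OccursIn x Γ = Σ Formula λ ψ → Γ ψ × Occurs x ψ

Thm : Relation → Formula → Set
Thm _⊢_ φ = ∅ ⊢ φ

DeductiveInterpolation : Relation → Set₁
DeductiveInterpolation _⊢_ =
  ∀ (Γ : FSet) (φ : Formula) → Γ ⊢ φ →
    Σ FSet λ Γ′ →
      (∀ ψ → Γ′ ψ → ∀ x → Occurs x ψ → OccursIn x Γ × Occurs x φ)
      × (∀ ψ → Γ′ ψ → Γ ⊢ ψ)
      × (Γ′ ⊢ φ)

GuardedInterpolation : Relation → Set
GuardedInterpolation _⊢_ =
  ∀ (φ ψ : Formula) → Thm _⊢_ (! φ ⇒ ! ψ) →
    Σ Formula λ δ →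
      (∀ x → Occurs x δ → Occurs x φ × Occurs x ψ)
      × Thm _⊢_ (! φ ⇒ ! δ)
      × Thm _⊢_ (! δ ⇒ ! ψ)

{-# OPTIONS --safe #-}
-- Local deduction theorem for !: the hypotheses from Γ used in a derivation of
-- Γ ∪ S ⊢LL φ form a conjunction α over the variables of Γ with Γ ⊢ α and
-- S ⊢LL !α → φ. This makes ⊢ !φ → !ψ equivalent to φ ⊢ ψ, so a guarded interpolant
-- of !α → !φ is a one-formula deductive interpolant, and a deductive interpolant Γ′
-- of φ ⊢ ψ collapses to the conjunction of its hypotheses used in deriving ψ.
module Submission where

open import Defs
open import Function.Bundles using (_⇔_; Equivalence; mk⇔)
open import Data.Product using (_×_; _,_)
open import Data.Sum using (inj₁; inj₂)
open import Relation.Unary using (_∪_; ∅; ｛_｝; _⊆_)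
open import Relation.Binary.PropositionalEquality using (refl)

weaken : ∀ {A B : FSet} {φ} → A ⊆ B → A ⊢LL φ → B ⊢LL φ
weaken A⊆B (hyp a)   = hyp (A⊆B a)
weaken A⊆B (ax a)    = ax a
weaken A⊆B (mp p q)  = mp (weaken A⊆B p) (weaken A⊆B q)
weaken A⊆B (adj p q) = adj (weaken A⊆B p) (weaken A⊆B q)
weaken A⊆B (nec p)   = nec (weaken A⊆B p)

module _ {Θ : FSet} where

  ⇒-trans : ∀ {α β γ} → Θ ⊢LL α ⇒ β → Θ ⊢LL β ⇒ γ → Θ ⊢LL α ⇒ γ
  ⇒-trans {α} {β} {γ} p q = mp q (mp p (ax (ax-trans α β γ)))

  ⇒-∧-intro : ∀ {α β γ} → Θ ⊢LL α ⇒ β → Θ ⊢LL α ⇒ γ → Θ ⊢LL α ⇒ β ∧′ γ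
  ⇒-∧-intro {α} {β} {γ} p q = mp (adj p q) (ax (ax-∧I α β γ))

  !-weaken : ∀ {α β} → Θ ⊢LL β → Θ ⊢LL ! α ⇒ β
  !-weaken {α} {β} p = mp p (ax (ax-!w α β))

  !-promote : ∀ {α β} → Θ ⊢LL ! α ⇒ β → Θ ⊢LL ! α ⇒ ! β
  !-promote {α} {β} p = ⇒-trans (ax (ax-!4 α)) (mp (nec p) (ax (ax-!K (! α) β)))

  !-mp : ∀ {χ α β} → Θ ⊢LL ! χ ⇒ α → Θ ⊢LL ! χ ⇒ (α ⇒ β) → Θ ⊢LL ! χ ⇒ β
  !-mp {χ} {α} {β} p q = mp (⇒-trans q (mp p (ax (ax-trans (! χ) α β)))) (ax (ax-!c χ β))

  !-∧-projₗ : ∀ {α β} → Θ ⊢LL ! (α ∧′ β) ⇒ ! α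
  !-∧-projₗ {α} {β} = mp (nec (ax (ax-∧l α β))) (ax (ax-!K (α ∧′ β) α))

  !-∧-projᵣ : ∀ {α β} → Θ ⊢LL ! (α ∧′ β) ⇒ ! β
  !-∧-projᵣ {α} {β} = mp (nec (ax (ax-∧r α β))) (ax (ax-!K (α ∧′ β) β))

!⇒!-elim : ∀ {S Γ : FSet} {φ ψ} →
  (∅ ∪ S) ⊢LL ! φ ⇒ ! ψ → (Γ ∪ S) ⊢LL φ → (Γ ∪ S) ⊢LL ψ
!⇒!-elim {ψ = ψ} ⊢!φ⇒!ψ ⊢φ =
  mp (mp (nec ⊢φ) (weaken (λ { (inj₂ s) → inj₂ s }) ⊢!φ⇒!ψ)) (ax (ax-!T ψ))

module _ {Γ S : FSet} where

  usedHyps : ∀ {φ} → (Γ ∪ S) ⊢LL φ → Formula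
  usedHyps {φ} (hyp (inj₁ _)) = φ
  usedHyps (hyp (inj₂ _))     = 𝟏
  usedHyps (ax _)             = 𝟏
  usedHyps (mp p q)           = usedHyps p ∧′ usedHyps q
  usedHyps (adj p q)          = usedHyps p ∧′ usedHyps q
  usedHyps (nec p)            = usedHyps p

  usedHyps-occurs : ∀ {φ x} (d : (Γ ∪ S) ⊢LL φ) → Occurs x (usedHyps d) → OccursIn x Γ
  usedHyps-occurs {φ} (hyp (inj₁ γ)) o = φ , γ , o
  usedHyps-occurs (mp p q)  (o-∧l o) = usedHyps-occurs p o
  usedHyps-occurs (mp p q)  (o-∧r o) = usedHyps-occurs q o
  usedHyps-occurs (adj p q) (o-∧l o) = usedHyps-occurs p o
  usedHyps-occurs (adj p q) (o-∧r o) = usedHyps-occurs q o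
  usedHyps-occurs (nec p)   o        = usedHyps-occurs p o

  usedHyps-!-intro : ∀ {Θ χ φ} (d : (Γ ∪ S) ⊢LL φ) →
    (∀ {γ} → Γ γ → Θ ⊢LL ! χ ⇒ γ) → Θ ⊢LL ! χ ⇒ usedHyps d
  usedHyps-!-intro (hyp (inj₁ γ)) f = f γ
  usedHyps-!-intro (hyp (inj₂ _)) f = !-weaken (ax ax-1)
  usedHyps-!-intro (ax _)         f = !-weaken (ax ax-1)
  usedHyps-!-intro (mp p q)  f = ⇒-∧-intro (usedHyps-!-intro p f) (usedHyps-!-intro q f)
  usedHyps-!-intro (adj p q) f = ⇒-∧-intro (usedHyps-!-intro p f) (usedHyps-!-intro q f)
  usedHyps-!-intro (nec p)   f = usedHyps-!-intro p f

  usedHyps-derivable : ∀ {Δ φ} (d : (Γ ∪ S) ⊢LL φ) →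
    (∀ {γ} → Γ γ → Δ ⊢LL γ) → Δ ⊢LL usedHyps d
  usedHyps-derivable d f = mp (nec (ax ax-1)) (usedHyps-!-intro d (λ γ → !-weaken (f γ)))

  usedHyps-deduction : ∀ {φ} (d : (Γ ∪ S) ⊢LL φ) → (∅ ∪ S) ⊢LL ! usedHyps d ⇒ φ
  usedHyps-deduction {φ} (hyp (inj₁ _)) = ax (ax-!T φ)
  usedHyps-deduction (hyp (inj₂ s))     = !-weaken (hyp (inj₂ s))
  usedHyps-deduction (ax a)             = !-weaken (ax a)
  usedHyps-deduction (mp p q) =
    !-mp (⇒-trans !-∧-projₗ (usedHyps-deduction p)) (⇒-trans !-∧-projᵣ (usedHyps-deduction q))
  usedHyps-deduction (adj p q) =
    ⇒-∧-intro (⇒-trans !-∧-projₗ (usedHyps-deduction p)) (⇒-trans !-∧-projᵣ (usedHyps-deduction q))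
  usedHyps-deduction (nec p) = !-promote (usedHyps-deduction p)

!-deduction : ∀ {S : FSet} {φ ψ} → (｛ φ ｝ ∪ S) ⊢LL ψ → (∅ ∪ S) ⊢LL ! φ ⇒ ψ
!-deduction {φ = φ} d =
  ⇒-trans (!-promote (usedHyps-!-intro d λ { refl → ax (ax-!T φ) })) (usedHyps-deduction d)

proposition3p17 : (_⊢_ : Relation) → AxiomaticExtension _⊢_ →
    DeductiveInterpolation _⊢_ ⇔ GuardedInterpolation _⊢_
proposition3p17 _⊢_ (S , _ , ⊢⇔⊢LL) = mk⇔ dip⇒gip gip⇒dip
  where
  toLL : ∀ {Γ φ} → Γ ⊢ φ → (Γ ∪ S) ⊢LL φ
  toLL {Γ} {φ} = Equivalence.to (⊢⇔⊢LL Γ φ)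

  fromLL : ∀ {Γ φ} → (Γ ∪ S) ⊢LL φ → Γ ⊢ φ
  fromLL {Γ} {φ} = Equivalence.from (⊢⇔⊢LL Γ φ)

  dip⇒gip : DeductiveInterpolation _⊢_ → GuardedInterpolation _⊢_
  dip⇒gip dip φ ψ ⊢!φ⇒!ψ
    with dip ｛ φ ｝ ψ (fromLL (!⇒!-elim (toLL ⊢!φ⇒!ψ) (hyp (inj₁ refl))))
  ... | Γ′ , Γ′-occurs , φ⊢Γ′ , Γ′⊢ψ =
    δ , δ-occurs , fromLL (!-promote (!-deduction φ⊢δ)) , fromLL (!-promote (usedHyps-deduction d))
    where
    d = toLL Γ′⊢ψ
    δ = usedHyps d
    φ⊢δ = usedHyps-derivable d (λ γ → toLL (φ⊢Γ′ _ γ))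
    δ-occurs : ∀ x → Occurs x δ → Occurs x φ × Occurs x ψ
    δ-occurs x o with usedHyps-occurs d o
    ... | χ , γ , oχ with Γ′-occurs χ γ x oχ
    ... | (_ , refl , oφ) , oψ = oφ , oψ

  gip⇒dip : GuardedInterpolation _⊢_ → DeductiveInterpolation _⊢_
  gip⇒dip gip Γ φ Γ⊢φ
    with d ← toLL Γ⊢φ
    with gip (usedHyps d) φ (fromLL (!-promote (usedHyps-deduction d)))
  ... | δ , δ-occurs , ⊢!α⇒!δ , ⊢!δ⇒!φ =
    ｛ δ ｝ , (λ { _ refl x o → let oα , oφ = δ-occurs x o in usedHyps-occurs d oα , oφ })
           , (λ { _ refl → fromLL (!⇒!-elim (toLL ⊢!α⇒!δ) (usedHyps-derivable d (λ γ → hyp (inj₁ γ)))) })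
           , fromLL (!⇒!-elim (toLL ⊢!δ⇒!φ) (hyp (inj₁ refl)))
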